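{- For $0\le\ell\le n$ let $M_{n,\ell}$ be the $n\times n$ matrix whose first $n-\ell$ diagonal entries equal $s+t$ and all of whose other entries equal $t$, and let $P_{n,\ell}(s,t)=\operatorname{per}(M_{n,\ell})$, with $P_{0,0}=1$. Then for $0\le\ell\le n$: (1) $\displaystyle P_{n,\ell}(s,t)=h_{n-\ell,\ell}(s,t)=\sum_{j=\ell}^{n}\binom{n-\ell}{n-j}\,j!\,s^{n-j}t^{j}$; (2) $\displaystyle P_{n,\ell}(s,t)=\sum_{j=0}^{\ell}\binom{\ell}{j}(-1)^j s^j\,P_{n-j,0}(s,t)$; (3) $\displaystyle s^n=\sum_{\ell=0}^{n}\binom{n}{\ell}(-1)^{\ell}\,P_{n,\ell}(s,t)$.
   Context: $\operatorname{per}$ denotes the permanent and $s,t$ are scalars (or indeterminates). $h_{a,b}(x,t)=\int_0^\infty (x+ty)^a(ty)^b e^{ -y}\,dy=\sum_{j=0}^a\binom aj (b+j)!\,x^{a-j}t^{b+j}$. -}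

module Defs where

open import Level using (Level)
open import Data.Nat using (ℕ; zero; suc; _∸_; _<_; _!) renaming (_+_ to _+ℕ_)
open import Data.Nat.Combinatorics using (_C_)
open import Data.Fin using (Fin; zero; suc; toℕ; punchIn)
open import Data.List using (List; []; _∷_; concatMap; map; foldr)
open import Data.List using () renaming (allFin to allFinL)
open import Data.Bool using (if_then_else_; _∧_)
open import Relation.Nullary.Decidable using (⌊_⌋)
open import Algebra.Bundles using (CommutativeRing)
import Data.Fin as F
import Data.Nat as N

-- A permutation of Fin (suc n) is determined by the image k of zero together with
-- a permutation σ of Fin n, via  zero ↦ k,  suc i ↦ punchIn k (σ i).
permutations : (n : ℕ) → List (Fin n → Fin n)
permutations zero = (λ ()) ∷ []
permutations (suc n) =
  concatMap (λ k → map (λ σ → extend k σ) (permutations n)) (allFinL (suc n))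
  where
  extend : Fin (suc n) → (Fin n → Fin n) → Fin (suc n) → Fin (suc n)
  extend k σ zero    = k
  extend k σ (suc i) = punchIn k (σ i)

module _ {c ℓ : Level} (R : CommutativeRing c ℓ) where
  open CommutativeRing R
  open import Algebra.Bundles using (Semiring)
  open import Algebra.Definitions.RawSemiring (Semiring.rawSemiring semiring) using (_×_; _^_; sum; product)

  pow : Carrier → ℕ → Carrier
  pow x n = x ^ n

  nat : ℕ → Carrier
  nat m = m × 1#

  per : (n : ℕ) → (Fin n → Fin n → Carrier) → Carrier
  per n M = foldr _+_ 0# (map (λ σ → product (λ i → M i (σ i))) (permutations n))

  -- Σ_{j=a}^{b} f j  (empty if b < a)
  sumFromTo : ℕ → ℕ → (ℕ → Carrier) → Carrier
  sumFromTo a b f = sum {suc b ∸ a} (λ k → f (a +ℕ toℕ k))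

  M : (n l : ℕ) → Carrier → Carrier → Fin n → Fin n → Carrier
  M n l s t i j =
    if ⌊ i F.≟ j ⌋ ∧ ⌊ toℕ i N.<? (n ∸ l) ⌋ then s + t else t

  P : (n l : ℕ) → Carrier → Carrier → Carrier
  P n l s t = per n (M n l s t)

  h : (a b : ℕ) → Carrier → Carrier → Carrier
  h a b x t = sumFromTo 0 a (λ j → nat ((a C j) N.* ((b +ℕ j) !)) * (x ^ (a ∸ j)) * (t ^ (b +ℕ j)))

-- Expanding the permanent along the row that carries the last diagonal entry s + t, and
-- splitting that entry as t + s, gives the recurrence P(n+1, ℓ) = P(n+1, ℓ+1) + s P(n, ℓ)
-- for ℓ ≤ n, while P(n, n) = n! tⁿ because every entry of M(n, n) equals t.  Each of the
-- three identities then follows by induction combined with Pascal's rule: (1) because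
-- h(m+1, ℓ) = h(m, ℓ+1) + s h(m, ℓ), (2) by solving the recurrence for P(n+1, ℓ+1), and
-- (3) by replacing s P(n, k) with P(n+1, k) - P(n+1, k+1) in s times the identity for n.
module Submission where

open import Defs
open import Level using (Level)
open import Function using (id; _∘_; _⇔_; mk⇔)
open import Data.Bool using (true; false; if_then_else_; _∧_)
open import Data.Bool.Properties using (∧-zeroʳ)
open import Data.Nat as ℕ using (ℕ; zero; suc; _∸_; _!; _≤_; s≤s; s<s; s<s⁻¹; s≤s⁻¹)
import Data.Nat.Properties as ℕ
open import Data.Nat.Combinatorics using (_C_; nCk+nC[k+1]≡[n+1]C[k+1]; k>n⇒nCk≡0; nCk≡nC[n∸k])
open import Data.Fin as Fin using (Fin; zero; suc; toℕ; punchIn; punchOut; fromℕ<)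
open import Data.Fin.Properties using (punchIn-injective; punchInᵢ≢i; punchIn-punchOut; suc-injective; toℕ-injective; toℕ-fromℕ<; toℕ≤pred[n])
open import Data.List as List using (List; []; _∷_; _++_; foldr; concatMap; tabulate)
open import Data.List.Properties using (map-concatMap)
open import Data.Product using (_,_)
open import Data.Vec.Functional using (Vector; updateAt)
open import Data.Vec.Functional.Properties using (updateAt-updates; updateAt-minimal)
open import Relation.Nullary.Decidable using (⌊_⌋; yes; no; isYes≗does; dec-true; dec-false; does-⇔)
open import Algebra.Bundles using (CommutativeRing; Semiring)
open import Relation.Nullary using (Dec; ¬_)
open import Relation.Binary.PropositionalEquality as ≡ using (_≡_; _≢_)

punchIn-punchIn-swap : ∀ {m} (c : Fin (suc (suc m))) (k j₀ : Fin (suc m)) →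
                       punchIn (punchIn c k) j₀ ≡ c →
                       ∀ j → punchIn (punchIn c k) (punchIn j₀ j) ≡ punchIn c (punchIn k j)
punchIn-punchIn-swap zero    k       zero     _  j       = ≡.refl
punchIn-punchIn-swap (suc c) zero    j₀       ≡.refl j   = ≡.refl
punchIn-punchIn-swap (suc c) (suc k) (suc j₀) eq zero    = ≡.refl
punchIn-punchIn-swap (suc c) (suc k) (suc j₀) eq (suc j) =
  ≡.cong suc (punchIn-punchIn-swap c k j₀ (suc-injective eq) j)

isYes-⇔ : ∀ {a b} {A : Set a} {B : Set b} → A ⇔ B → (a? : Dec A) (b? : Dec B) → ⌊ a? ⌋ ≡ ⌊ b? ⌋
isYes-⇔ A⇔B a? b? = ≡.trans (isYes≗does a?) (≡.trans (does-⇔ A⇔B a? b?) (≡.sym (isYes≗does b?)))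

isYes-true : ∀ {a} {A : Set a} (a? : Dec A) → A → ⌊ a? ⌋ ≡ true
isYes-true a? x = ≡.trans (isYes≗does a?) (dec-true a? x)

isYes-false : ∀ {a} {A : Set a} (a? : Dec A) → ¬ A → ⌊ a? ⌋ ≡ false
isYes-false a? ¬x = ≡.trans (isYes≗does a?) (dec-false a? ¬x)

<?-suc : ∀ a b → ⌊ suc a ℕ.<? suc b ⌋ ≡ ⌊ a ℕ.<? b ⌋
<?-suc a b = isYes-⇔ (mk⇔ s<s⁻¹ s<s) (suc a ℕ.<? suc b) (a ℕ.<? b)

<?-suc-≢ : ∀ {a m} → a ≢ m → ⌊ a ℕ.<? suc m ⌋ ≡ ⌊ a ℕ.<? m ⌋
<?-suc-≢ {a} {m} a≢m =
  isYes-⇔ (mk⇔ (λ a<1+m → ℕ.≤∧≢⇒< (s≤s⁻¹ a<1+m) a≢m) ℕ.m<n⇒m<1+n) (a ℕ.<? suc m) (a ℕ.<? m)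

<?-punchIn : ∀ {n} (r : Fin (suc n)) (i : Fin n) →
             ⌊ toℕ (punchIn r i) ℕ.<? suc (toℕ r) ⌋ ≡ ⌊ toℕ i ℕ.<? toℕ r ⌋
<?-punchIn zero    i       = <?-suc (toℕ i) 0
<?-punchIn (suc r) zero    = ≡.refl
<?-punchIn (suc r) (suc i) = ≡.trans (<?-suc _ _) (≡.trans (<?-punchIn r i) (≡.sym (<?-suc _ _)))

≟-punchIn : ∀ {n} (r : Fin (suc n)) (i j : Fin n) → ⌊ punchIn r i Fin.≟ punchIn r j ⌋ ≡ ⌊ i Fin.≟ j ⌋
≟-punchIn r i j = isYes-⇔ (mk⇔ (punchIn-injective r i j) (≡.cong (punchIn r))) (punchIn r i Fin.≟ punchIn r j) (i Fin.≟ j)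

module Permanent {c ℓ : Level} (R : CommutativeRing c ℓ) where
  open CommutativeRing R hiding (zero)
  open import Algebra.Properties.Semiring.Sum semiring
  open import Algebra.Properties.Semiring.Mult semiring using (×-assoc-*; ×-congʳ; _×_; ×1-homo-*)
  open import Relation.Binary.Reasoning.Setoid setoid
  open import Algebra.Properties.CommutativeSemigroup *-commutativeSemigroup using (x∙yz≈y∙xz)
  open import Algebra.Solver.Ring.NaturalCoefficients.Default commutativeSemiring using (solve; _:=_; _:*_)
  open import Algebra.Definitions.RawSemiring (Semiring.rawSemiring semiring) using (product; _^_)

  Matrix : ℕ → Set c
  Matrix n = Fin n → Fin n → Carrier

  minor : ∀ {n} → Matrix (suc n) → Fin (suc n) → Fin (suc n) → Matrix n
  minor A r c i j = A (punchIn r i) (punchIn c j)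

  laplace : (n : ℕ) → Matrix n → Carrier
  laplace zero    A = 1#
  laplace (suc n) A = ∑[ k < suc n ] (A zero k * laplace n (minor A zero k))

  ∑ₗ : List Carrier → Carrier
  ∑ₗ = foldr _+_ 0#

  ∑ₗ-++ : ∀ xs ys → ∑ₗ (xs ++ ys) ≈ ∑ₗ xs + ∑ₗ ys
  ∑ₗ-++ []       ys = sym (+-identityˡ _)
  ∑ₗ-++ (x ∷ xs) ys = trans (+-congˡ (∑ₗ-++ xs ys)) (sym (+-assoc _ _ _))

  ∑ₗ-concatMap-tabulate : ∀ {a} {X : Set a} {n} (F : X → List Carrier) (f : Fin n → X) →
                          ∑ₗ (concatMap F (tabulate f)) ≈ ∑[ k < n ] ∑ₗ (F (f k))
  ∑ₗ-concatMap-tabulate {n = zero}  F f = refl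
  ∑ₗ-concatMap-tabulate {n = suc n} F f =
    trans (∑ₗ-++ (F (f zero)) _) (+-congˡ (∑ₗ-concatMap-tabulate F (f ∘ suc)))

  ∑ₗ-map-map : ∀ {a b} {X : Set a} {Y : Set b} (g : Y → Carrier) (e : X → Y) x (f : X → Carrier) →
                (∀ σ → g (e σ) ≈ x * f σ) →
                ∀ xs → ∑ₗ (List.map g (List.map e xs)) ≈ x * ∑ₗ (List.map f xs)
  ∑ₗ-map-map g e x f g∘e≈x*f []       = sym (zeroʳ x)
  ∑ₗ-map-map g e x f g∘e≈x*f (σ ∷ xs) =
    trans (+-cong (g∘e≈x*f σ) (∑ₗ-map-map g e x f g∘e≈x*f xs)) (sym (distribˡ x _ _))

  per≈laplace : ∀ n (A : Matrix n) → per R n A ≈ laplace n A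
  per≈laplace zero    A = +-identityʳ 1#
  per≈laplace (suc n) A = expand _ (λ _ _ → refl)
    where
    term : (Fin (suc n) → Fin (suc n)) → Carrier
    term σ = product (λ i → A i (σ i))

    -- e abstracts the extension map local to Defs.permutations, which cannot be named here.
    expand : (e : Fin (suc n) → (Fin n → Fin n) → Fin (suc n) → Fin (suc n)) →
             (∀ k σ → term (e k σ) ≈ A zero k * product (λ i → minor A zero k i (σ i))) →
             ∑ₗ (List.map term (concatMap (λ k → List.map (e k) (permutations n)) (List.allFin (suc n))))
               ≈ laplace (suc n) A
    expand e term∘e = begin
      ∑ₗ (List.map term (concatMap (λ k → List.map (e k) (permutations n)) (List.allFin (suc n))))
        ≡⟨ ≡.cong ∑ₗ (map-concatMap term (λ k → List.map (e k) (permutations n)) (List.allFin (suc n))) ⟩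
      ∑ₗ (concatMap (λ k → List.map term (List.map (e k) (permutations n))) (List.allFin (suc n)))
        ≈⟨ ∑ₗ-concatMap-tabulate (λ k → List.map term (List.map (e k) (permutations n))) id ⟩
      ∑[ k < suc n ] ∑ₗ (List.map term (List.map (e k) (permutations n)))
        ≈⟨ sum-cong-≋ (λ k → ∑ₗ-map-map term (e k) (A zero k) (λ σ → product (λ i → minor A zero k i (σ i)))
                                        (term∘e k) (permutations n)) ⟩
      ∑[ k < suc n ] (A zero k * per R n (minor A zero k))
        ≈⟨ sum-cong-≋ (λ k → *-congˡ {A zero k} (per≈laplace n (minor A zero k))) ⟩
      laplace (suc n) A ∎

  laplace-cong : ∀ n {A B : Matrix n} → (∀ i j → A i j ≈ B i j) → laplace n A ≈ laplace n B
  laplace-cong zero    A≈B = refl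
  laplace-cong (suc n) A≈B =
    sum-cong-≋ λ k → *-cong (A≈B zero k) (laplace-cong n λ i j → A≈B (suc i) (punchIn k j))

  sum-≈0 : ∀ {n} {f : Vector Carrier n} → (∀ k → f k ≈ 0#) → sum f ≈ 0#
  sum-≈0 {n} f≈0 = trans (sum-cong-≋ f≈0) (sum-replicate-zero n)

  laplace-zero-row : ∀ n (A : Matrix n) r → (∀ j → A r j ≈ 0#) → laplace n A ≈ 0#
  laplace-zero-row (suc n) A zero A₀≈0 =
    sum-≈0 λ k → trans (*-congʳ (A₀≈0 k)) (zeroˡ (laplace n (minor A zero k)))
  laplace-zero-row (suc (suc n)) A (suc r) Ar≈0 =
    sum-≈0 λ k → trans (*-congˡ (laplace-zero-row (suc n) (minor A zero k) r λ j → Ar≈0 (punchIn k j))) (zeroʳ (A zero k))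

  laplace-additive-row : ∀ n (A B B′ : Matrix n) r →
                         (∀ i → i ≢ r → ∀ j → A i j ≈ B i j) →
                         (∀ i → i ≢ r → ∀ j → A i j ≈ B′ i j) →
                         (∀ j → A r j ≈ B r j + B′ r j) →
                         laplace n A ≈ laplace n B + laplace n B′
  laplace-additive-row (suc n) A B B′ zero A≈B A≈B′ Ar≈Br+B′r = begin
      ∑[ k < suc n ] (A zero k * laplace n (minor A zero k))
        ≈⟨ sum-cong-≋ (λ k → trans (*-congʳ (Ar≈Br+B′r k)) (distribʳ (L k) (B zero k) (B′ zero k))) ⟩
      ∑[ k < suc n ] (B zero k * L k + B′ zero k * L k)
        ≈⟨ ∑-distrib-+ (λ k → B zero k * L k) (λ k → B′ zero k * L k) ⟩
      ∑[ k < suc n ] (B zero k * L k) + ∑[ k < suc n ] (B′ zero k * L k)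
        ≈⟨ +-cong (sum-cong-≋ λ k → *-congˡ {B zero k} (laplace-cong n λ i j → A≈B (suc i) (λ ()) (punchIn k j)))
                  (sum-cong-≋ λ k → *-congˡ {B′ zero k} (laplace-cong n λ i j → A≈B′ (suc i) (λ ()) (punchIn k j))) ⟩
      laplace (suc n) B + laplace (suc n) B′ ∎
    where
    L : Fin (suc n) → Carrier
    L k = laplace n (minor A zero k)
  laplace-additive-row (suc (suc n)) A B B′ (suc r) A≈B A≈B′ Ar≈Br+B′r = begin
      ∑[ k < suc (suc n) ] (A zero k * laplace (suc n) (minor A zero k))
        ≈⟨ sum-cong-≋ (λ k → trans (*-congˡ (minor-additive k)) (distribˡ (A zero k) (L B k) (L B′ k))) ⟩
      ∑[ k < suc (suc n) ] (A zero k * L B k + A zero k * L B′ k)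
        ≈⟨ ∑-distrib-+ (λ k → A zero k * L B k) (λ k → A zero k * L B′ k) ⟩
      ∑[ k < suc (suc n) ] (A zero k * L B k) + ∑[ k < suc (suc n) ] (A zero k * L B′ k)
        ≈⟨ +-cong (sum-cong-≋ λ k → *-congʳ {L B k} (A≈B zero (λ ()) k))
                  (sum-cong-≋ λ k → *-congʳ {L B′ k} (A≈B′ zero (λ ()) k)) ⟩
      laplace (suc (suc n)) B + laplace (suc (suc n)) B′ ∎
    where
    L : Matrix (suc (suc n)) → Fin (suc (suc n)) → Carrier
    L X k = laplace (suc n) (minor X zero k)
    minor-additive : ∀ k → L A k ≈ L B k + L B′ k
    minor-additive k = laplace-additive-row (suc n) (minor A zero k) (minor B zero k) (minor B′ zero k) r
      (λ i i≢r j → A≈B (suc i) (i≢r ∘ suc-injective) (punchIn k j))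
      (λ i i≢r j → A≈B′ (suc i) (i≢r ∘ suc-injective) (punchIn k j))
      (λ j → Ar≈Br+B′r (punchIn k j))

  -- For r ≠ 0, expanding along row 0 leaves a zero row in the minor at column c and a unit row
  -- in every other minor; punchIn-punchIn-swap identifies the resulting minors of minors.
  laplace-unit-row : ∀ n (A : Matrix (suc n)) r c x → A r c ≈ x → (∀ j → j ≢ c → A r j ≈ 0#) →
                     laplace (suc n) A ≈ x * laplace n (minor A r c)
  laplace-unit-row n A zero c x Arc≈x Arj≈0 = begin
      laplace (suc n) A
        ≈⟨ sum-remove {i = c} (λ k → A zero k * L k) ⟩
      A zero c * L c + ∑[ k < n ] (A zero (punchIn c k) * L (punchIn c k))
        ≈⟨ +-cong (*-congʳ Arc≈x) (sum-≈0 λ k → trans (*-congʳ (Arj≈0 _ (punchInᵢ≢i c k))) (zeroˡ (L (punchIn c k)))) ⟩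
      x * L c + 0#
        ≈⟨ +-identityʳ _ ⟩
      x * L c ∎
    where
    L : Fin (suc n) → Carrier
    L k = laplace n (minor A zero k)
  laplace-unit-row (suc n) A (suc r) c x Arc≈x Arj≈0 = begin
      laplace (suc (suc n)) A
        ≈⟨ sum-remove {i = c} (λ k → A zero k * L k) ⟩
      A zero c * L c + ∑[ k < suc n ] (A zero (punchIn c k) * L (punchIn c k))
        ≈⟨ +-cong (trans (*-congˡ (laplace-zero-row (suc n) (minor A zero c) r λ j → Arj≈0 _ (punchInᵢ≢i c j))) (zeroʳ (A zero c)))
                  (sum-cong-≋ λ k → *-congˡ {A zero (punchIn c k)} (minor-unit-row k)) ⟩
      0# + ∑[ k < suc n ] (A zero (punchIn c k) * (x * L′ k))
        ≈⟨ trans (+-identityˡ _) (sum-cong-≋ λ k → x∙yz≈y∙xz (A zero (punchIn c k)) x (L′ k)) ⟩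
      ∑[ k < suc n ] (x * (A zero (punchIn c k) * L′ k))
        ≈⟨ *-distribˡ-sum x (λ k → A zero (punchIn c k) * L′ k) ⟨
      x * laplace (suc n) (minor A (suc r) c) ∎
    where
    L : Fin (suc (suc n)) → Carrier
    L k = laplace (suc n) (minor A zero k)
    L′ : Fin (suc n) → Carrier
    L′ k = laplace n (minor (minor A (suc r) c) zero k)
    minor-unit-row : ∀ k → L (punchIn c k) ≈ x * L′ k
    minor-unit-row k =
      trans (laplace-unit-row n (minor A zero (punchIn c k)) r j₀ x
               (trans (reflexive (≡.cong (A (suc r)) c-at-j₀)) Arc≈x)
               (λ j j≢j₀ → Arj≈0 _ (j≢j₀ ∘ λ eq → punchIn-injective (punchIn c k) j j₀ (≡.trans eq (≡.sym c-at-j₀)))))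
            (*-congˡ (laplace-cong n λ i j → reflexive (≡.cong (A (suc (punchIn r i))) (punchIn-punchIn-swap c k j₀ c-at-j₀ j))))
      where
      j₀ : Fin (suc n)
      j₀ = punchOut (punchInᵢ≢i c k)
      c-at-j₀ : punchIn (punchIn c k) j₀ ≡ c
      c-at-j₀ = punchIn-punchOut (punchInᵢ≢i c k)

  laplace-split-row : ∀ n (A B : Matrix (suc n)) r c x →
                      (∀ i → i ≢ r → ∀ j → A i j ≈ B i j) →
                      A r c ≈ B r c + x →
                      (∀ j → j ≢ c → A r j ≈ B r j) →
                      laplace (suc n) A ≈ laplace (suc n) B + x * laplace n (minor A r c)
  laplace-split-row n A B r c x A≈B Arc≈Brc+x Arj≈Brj = begin
      laplace (suc n) A
        ≈⟨ laplace-additive-row (suc n) A B U r A≈B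
             (λ i i≢r j → reflexive (≡.cong (λ row → row j) (≡.sym (U-off i i≢r)))) Ar≈Br+Ur ⟩
      laplace (suc n) B + laplace (suc n) U
        ≈⟨ +-congˡ (laplace-unit-row n U r c x (reflexive U-at-c) λ j j≢c → reflexive (U-off-c j j≢c)) ⟩
      laplace (suc n) B + x * laplace n (minor U r c)
        ≈⟨ +-congˡ (*-congˡ (laplace-cong n λ i j →
             reflexive (≡.cong (λ row → row (punchIn c j)) (U-off (punchIn r i) (punchInᵢ≢i r i))))) ⟩
      laplace (suc n) B + x * laplace n (minor A r c) ∎
    where
    unit : Vector Carrier (suc n)
    unit = updateAt (λ _ → 0#) c (λ _ → x)
    U : Matrix (suc n)
    U = updateAt A r (λ _ → unit)
    U-off : ∀ i → i ≢ r → U i ≡ A i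
    U-off i i≢r = updateAt-minimal i r A i≢r
    U-row : ∀ j → U r j ≡ unit j
    U-row j = ≡.cong (λ row → row j) (updateAt-updates r A)
    U-at-c : U r c ≡ x
    U-at-c = ≡.trans (U-row c) (updateAt-updates c (λ _ → 0#))
    U-off-c : ∀ j → j ≢ c → U r j ≡ 0#
    U-off-c j j≢c = ≡.trans (U-row j) (updateAt-minimal j c (λ _ → 0#) j≢c)
    Ar≈Br+Ur : ∀ j → A r j ≈ B r j + U r j
    Ar≈Br+Ur j with j Fin.≟ c
    ... | yes ≡.refl = trans Arc≈Brc+x (+-congˡ (reflexive (≡.sym U-at-c)))
    ... | no j≢c = trans (Arj≈Brj j j≢c) (trans (sym (+-identityʳ _)) (+-congˡ (reflexive (≡.sym (U-off-c j j≢c)))))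

  laplace-const : ∀ n x → laplace n (λ _ _ → x) ≈ nat R (n !) * x ^ n
  laplace-const zero    x = sym (trans (*-identityʳ _) (+-identityʳ 1#))
  laplace-const (suc n) x = begin
      ∑[ k < suc n ] (x * laplace n (λ _ _ → x))
        ≈⟨ sum-cong-≋ {suc n} (λ _ → *-congˡ {x} (laplace-const n x)) ⟩
      ∑[ k < suc n ] (x * (nat R (n !) * x ^ n))
        ≈⟨ sum-replicate (suc n) ⟩
      suc n × (x * (nat R (n !) * x ^ n))
        ≈⟨ ×-congʳ (suc n) (*-identityˡ _) ⟨
      suc n × (1# * (x * (nat R (n !) * x ^ n)))
        ≈⟨ ×-assoc-* (suc n) 1# _ ⟨
      nat R (suc n) * (x * (nat R (n !) * x ^ n))
        ≈⟨ solve 4 (λ a b y z → a :* (y :* (b :* z)) := (a :* b) :* (y :* z)) refl (nat R (suc n)) (nat R (n !)) x (x ^ n) ⟩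
      nat R (suc n) * nat R (n !) * (x * x ^ n)
        ≈⟨ *-congʳ (×1-homo-* (suc n) (n !)) ⟨
      nat R (suc n ℕ.* n !) * (x * x ^ n) ∎

module BinomialSums {c ℓ : Level} (R : CommutativeRing c ℓ) where
  open CommutativeRing R hiding (zero)
  open import Algebra.Properties.Semiring.Sum semiring using (sum-cong-≋; ∑-distrib-+; *-distribˡ-sum)
  open import Algebra.Properties.Semiring.Mult semiring using (×-homo-+)
  open import Algebra.Properties.CommutativeSemigroup +-commutativeSemigroup using (x∙yz≈xz∙y)
  open import Algebra.Properties.Ring ring using (-1*x≈-x)
  open import Algebra.Properties.Group +-group using (//-rightDividesʳ)
  open import Relation.Binary.Reasoning.Setoid setoid

  sumFromTo-cong : ∀ n {f g : ℕ → Carrier} → (∀ j → j ≤ n → f j ≈ g j) →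
                   sumFromTo R 0 n f ≈ sumFromTo R 0 n g
  sumFromTo-cong n f≈g = sum-cong-≋ {suc n} λ k → f≈g (toℕ k) (toℕ≤pred[n] k)

  sumFromTo-*ˡ : ∀ x n (f : ℕ → Carrier) → x * sumFromTo R 0 n f ≈ sumFromTo R 0 n (λ j → x * f j)
  sumFromTo-*ˡ x n f = *-distribˡ-sum {suc n} x (λ k → f (toℕ k))

  sumFromTo-+ : ∀ n (f g : ℕ → Carrier) →
                sumFromTo R 0 n (λ j → f j + g j) ≈ sumFromTo R 0 n f + sumFromTo R 0 n g
  sumFromTo-+ n f g = ∑-distrib-+ {suc n} (λ k → f (toℕ k)) (λ k → g (toℕ k))

  sumFromTo-offset : ∀ a m (f : ℕ → Carrier) → sumFromTo R a (a ℕ.+ m) f ≈ sumFromTo R 0 m (λ j → f (a ℕ.+ j))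
  sumFromTo-offset zero    m f = refl
  sumFromTo-offset (suc a) m f = sumFromTo-offset a m (f ∘ suc)

  sumFromTo-init : ∀ n (f : ℕ → Carrier) → f (suc n) ≈ 0# → sumFromTo R 0 (suc n) f ≈ sumFromTo R 0 n f
  sumFromTo-init zero    f f1≈0 = +-congˡ (trans (+-identityʳ _) f1≈0)
  sumFromTo-init (suc n) f fn≈0 = +-congˡ (sumFromTo-init n (f ∘ suc) fn≈0)

  nat[nC0]*x≈x : ∀ n x → nat R (n C 0) * x ≈ x
  nat[nC0]*x≈x n x = trans (*-congʳ (+-identityʳ 1#)) (*-identityˡ x)

  pascal : ∀ m (f : ℕ → Carrier) →
           sumFromTo R 0 (suc m) (λ j → nat R (suc m C j) * f j)
             ≈ sumFromTo R 0 m (λ j → nat R (m C j) * f j) + sumFromTo R 0 m (λ j → nat R (m C j) * f (suc j))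
  pascal m f = begin
      sumFromTo R 0 (suc m) (λ j → nat R (suc m C j) * f j)
        ≡⟨⟩
      nat R (suc m C 0) * f 0 + sumFromTo R 0 m (λ j → nat R (suc m C suc j) * f (suc j))
        ≈⟨ +-cong (nat[nC0]*x≈x (suc m) (f 0)) (sumFromTo-cong m λ j _ → split j) ⟩
      f 0 + sumFromTo R 0 m (λ j → nat R (m C j) * f (suc j) + nat R (m C suc j) * f (suc j))
        ≈⟨ +-congˡ (sumFromTo-+ m (λ j → nat R (m C j) * f (suc j)) (λ j → nat R (m C suc j) * f (suc j))) ⟩
      f 0 + (S + sumFromTo R 0 m (λ j → nat R (m C suc j) * f (suc j)))
        ≈⟨ x∙yz≈xz∙y (f 0) S _ ⟩
      (f 0 + sumFromTo R 0 m (λ j → nat R (m C suc j) * f (suc j))) + S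
        ≈⟨ +-congʳ (+-congʳ (nat[nC0]*x≈x m (f 0))) ⟨
      sumFromTo R 0 (suc m) (λ j → nat R (m C j) * f j) + S
        ≈⟨ +-congʳ (sumFromTo-init m (λ j → nat R (m C j) * f j) top-vanishes) ⟩
      sumFromTo R 0 m (λ j → nat R (m C j) * f j) + S ∎
    where
    S : Carrier
    S = sumFromTo R 0 m (λ j → nat R (m C j) * f (suc j))
    split : ∀ j → nat R (suc m C suc j) * f (suc j) ≈ nat R (m C j) * f (suc j) + nat R (m C suc j) * f (suc j)
    split j = trans (*-congʳ (trans (reflexive (≡.cong (nat R) (≡.sym (nCk+nC[k+1]≡[n+1]C[k+1] m j))))
                                    (×-homo-+ 1# (m C j) (m C suc j))))
                    (distribʳ _ _ _)
    top-vanishes : nat R (m C suc m) * f (suc m) ≈ 0#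
    top-vanishes = trans (*-congʳ (reflexive (≡.cong (nat R) (k>n⇒nCk≡0 (ℕ.n<1+n m))))) (zeroˡ _)

  x+y+[-1]y≈x : ∀ x y → x + y + - 1# * y ≈ x
  x+y+[-1]y≈x x y = trans (+-congˡ (-1*x≈-x y)) (//-rightDividesʳ y x)

  x≈y+z⇒y≈x+[-1]z : ∀ {x y z} → x ≈ y + z → y ≈ x + - 1# * z
  x≈y+z⇒y≈x+[-1]z {_} {y} {z} x≈y+z = trans (sym (x+y+[-1]y≈x y z)) (+-congʳ (sym x≈y+z))

module PermanentOfM {c ℓ : Level} (R : CommutativeRing c ℓ) (s t : CommutativeRing.Carrier R) where
  open CommutativeRing R hiding (zero)
  open Permanent R
  open BinomialSums R
  open import Algebra.Properties.Semiring.Mult semiring using (×1-homo-*)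
  open import Algebra.Definitions.RawSemiring (Semiring.rawSemiring semiring) using (_^_)
  open import Algebra.Solver.Ring.NaturalCoefficients.Default commutativeSemiring using (solve; _:=_; _:*_; _:+_)
  open import Relation.Binary.Reasoning.Setoid setoid

  P′ : ℕ → ℕ → Carrier
  P′ n l = P R n l s t

  h′ : ℕ → ℕ → Carrier
  h′ m l = h R m l s t

  -- M n l s t unfolds to prefixDiagonal n (n ∸ l).
  prefixDiagonal : (n m : ℕ) → Matrix n
  prefixDiagonal n m i j = if ⌊ i Fin.≟ j ⌋ ∧ ⌊ toℕ i ℕ.<? m ⌋ then s + t else t

  prefixDiagonal-offDiagonal : ∀ {n} m {i j : Fin n} → i ≢ j → prefixDiagonal n m i j ≡ t
  prefixDiagonal-offDiagonal m {i} {j} i≢j =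
    ≡.cong (λ b → if b ∧ ⌊ toℕ i ℕ.<? m ⌋ then s + t else t) (isYes-false (i Fin.≟ j) i≢j)

  prefixDiagonal-zero : ∀ {n} (i j : Fin n) → prefixDiagonal n 0 i j ≡ t
  prefixDiagonal-zero i j = ≡.cong (λ b → if b then s + t else t) (∧-zeroʳ ⌊ i Fin.≟ j ⌋)

  prefixDiagonal-diagonal : ∀ {n} m (i : Fin n) → prefixDiagonal n m i i ≡ (if ⌊ toℕ i ℕ.<? m ⌋ then s + t else t)
  prefixDiagonal-diagonal m i = ≡.cong (λ b → if b ∧ ⌊ toℕ i ℕ.<? m ⌋ then s + t else t) (isYes-true (i Fin.≟ i) ≡.refl)

  laplace-prefixDiagonal-step : ∀ {n} (r : Fin (suc n)) →
    laplace (suc n) (prefixDiagonal (suc n) (suc (toℕ r)))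
      ≈ laplace (suc n) (prefixDiagonal (suc n) (toℕ r)) + s * laplace n (prefixDiagonal n (toℕ r))
  laplace-prefixDiagonal-step {n} r =
    trans (laplace-split-row n (prefixDiagonal (suc n) (suc (toℕ r))) (prefixDiagonal (suc n) (toℕ r)) r r s
             rows-agree diagonal-splits row-agrees)
          (+-congˡ (*-congˡ (laplace-cong n minor-is-prefixDiagonal)))
    where
    rows-agree : ∀ i → i ≢ r → ∀ j → prefixDiagonal (suc n) (suc (toℕ r)) i j ≈ prefixDiagonal (suc n) (toℕ r) i j
    rows-agree i i≢r j = reflexive (≡.cong (λ b → if ⌊ i Fin.≟ j ⌋ ∧ b then s + t else t) (<?-suc-≢ (i≢r ∘ toℕ-injective)))
    diagonal-splits : prefixDiagonal (suc n) (suc (toℕ r)) r r ≈ prefixDiagonal (suc n) (toℕ r) r r + s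
    diagonal-splits = begin
      prefixDiagonal (suc n) (suc (toℕ r)) r r  ≡⟨ inside ⟩
      s + t                                     ≈⟨ +-comm s t ⟩
      t + s                                     ≡⟨ ≡.cong (_+ s) outside ⟨
      prefixDiagonal (suc n) (toℕ r) r r + s    ∎
      where
      inside : prefixDiagonal (suc n) (suc (toℕ r)) r r ≡ s + t
      inside = ≡.trans (prefixDiagonal-diagonal (suc (toℕ r)) r)
                       (≡.cong (if_then s + t else t) (isYes-true (toℕ r ℕ.<? suc (toℕ r)) (ℕ.n<1+n (toℕ r))))
      outside : prefixDiagonal (suc n) (toℕ r) r r ≡ t
      outside = ≡.trans (prefixDiagonal-diagonal (toℕ r) r)
                        (≡.cong (if_then s + t else t) (isYes-false (toℕ r ℕ.<? toℕ r) (ℕ.<-irrefl ≡.refl)))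
    row-agrees : ∀ j → j ≢ r → prefixDiagonal (suc n) (suc (toℕ r)) r j ≈ prefixDiagonal (suc n) (toℕ r) r j
    row-agrees j j≢r = reflexive (≡.trans (prefixDiagonal-offDiagonal _ (j≢r ∘ ≡.sym))
                                         (≡.sym (prefixDiagonal-offDiagonal _ (j≢r ∘ ≡.sym))))
    minor-is-prefixDiagonal : ∀ i j → minor (prefixDiagonal (suc n) (suc (toℕ r))) r r i j ≈ prefixDiagonal n (toℕ r) i j
    minor-is-prefixDiagonal i j = reflexive (≡.cong₂ (λ a b → if a ∧ b then s + t else t) (≟-punchIn r i j) (<?-punchIn r i))

  per-prefixDiagonal-step : ∀ {n m} → m ≤ n →
    per R (suc n) (prefixDiagonal (suc n) (suc m)) ≈ per R (suc n) (prefixDiagonal (suc n) m) + s * per R n (prefixDiagonal n m)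
  per-prefixDiagonal-step {n} {m} m≤n = ≡.subst Step (toℕ-fromℕ< (s≤s m≤n)) (step (fromℕ< (s≤s m≤n)))
    where
    Step : ℕ → Set ℓ
    Step m = per R (suc n) (prefixDiagonal (suc n) (suc m)) ≈ per R (suc n) (prefixDiagonal (suc n) m) + s * per R n (prefixDiagonal n m)
    step : ∀ r → Step (toℕ r)
    step r = trans (per≈laplace (suc n) (prefixDiagonal (suc n) (suc (toℕ r))))
             (trans (laplace-prefixDiagonal-step r)
                    (sym (+-cong (per≈laplace (suc n) (prefixDiagonal (suc n) (toℕ r)))
                                 (*-congˡ (per≈laplace n (prefixDiagonal n (toℕ r)))))))

  P-recurrence : ∀ {n l} → l ≤ n → P′ (suc n) l ≈ P′ (suc n) (suc l) + s * P′ n l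
  P-recurrence {n} {l} l≤n = begin
      P′ (suc n) l
        ≡⟨ ≡.cong (λ m → per R (suc n) (prefixDiagonal (suc n) m)) (ℕ.+-∸-assoc 1 l≤n) ⟩
      per R (suc n) (prefixDiagonal (suc n) (suc (n ∸ l)))
        ≈⟨ per-prefixDiagonal-step (ℕ.m∸n≤m n l) ⟩
      P′ (suc n) (suc l) + s * P′ n l ∎

  P[n,n]≈n!*tⁿ : ∀ n → P′ n n ≈ nat R (n !) * t ^ n
  P[n,n]≈n!*tⁿ n = begin
      P′ n n                          ≡⟨ ≡.cong (λ m → per R n (prefixDiagonal n m)) (ℕ.n∸n≡0 n) ⟩
      per R n (prefixDiagonal n 0)    ≈⟨ per≈laplace n (prefixDiagonal n 0) ⟩
      laplace n (prefixDiagonal n 0)  ≈⟨ laplace-cong n (λ i j → reflexive (prefixDiagonal-zero i j)) ⟩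
      laplace n (λ _ _ → t)           ≈⟨ laplace-const n t ⟩
      nat R (n !) * t ^ n             ∎

  hTerm : ℕ → ℕ → ℕ → Carrier
  hTerm m l j = nat R ((m C j) ℕ.* ((l ℕ.+ j) !)) * s ^ (m ∸ j) * t ^ (l ℕ.+ j)

  h[0,l]≈l!*tˡ : ∀ l → h′ 0 l ≈ nat R (l !) * t ^ l
  h[0,l]≈l!*tˡ l = begin
      hTerm 0 l 0 + 0#                                  ≈⟨ +-identityʳ _ ⟩
      nat R (1 ℕ.* (l ℕ.+ 0) !) * 1# * t ^ (l ℕ.+ 0)     ≈⟨ *-congʳ (*-identityʳ _) ⟩
      nat R (1 ℕ.* (l ℕ.+ 0) !) * t ^ (l ℕ.+ 0)          ≡⟨ ≡.cong (λ k → nat R (1 ℕ.* k !) * t ^ k) (ℕ.+-identityʳ l) ⟩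
      nat R (1 ℕ.* l !) * t ^ l                         ≡⟨ ≡.cong (λ a → nat R a * t ^ l) (ℕ.*-identityˡ (l !)) ⟩
      nat R (l !) * t ^ l                               ∎

  h-suc : ∀ m l → h′ (suc m) l ≈ h′ m (suc l) + s * h′ m l
  h-suc m l = begin
      h′ (suc m) l
        ≈⟨ sumFromTo-cong (suc m) (λ j _ → split-binomial j) ⟩
      sumFromTo R 0 (suc m) (λ j → nat R (suc m C j) * F j)
        ≈⟨ pascal m F ⟩
      sumFromTo R 0 m (λ j → nat R (m C j) * F j) + sumFromTo R 0 m (λ j → nat R (m C j) * F (suc j))
        ≈⟨ +-comm _ _ ⟩
      sumFromTo R 0 m (λ j → nat R (m C j) * F (suc j)) + sumFromTo R 0 m (λ j → nat R (m C j) * F j)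
        ≈⟨ +-cong (sumFromTo-cong m λ j _ → shift-t j) (sumFromTo-cong m shift-s) ⟩
      h′ m (suc l) + sumFromTo R 0 m (λ j → s * hTerm m l j)
        ≈⟨ +-congˡ (sumFromTo-*ˡ s m (hTerm m l)) ⟨
      h′ m (suc l) + s * h′ m l ∎
    where
    F : ℕ → Carrier
    F j = nat R ((l ℕ.+ j) !) * (s ^ (suc m ∸ j) * t ^ (l ℕ.+ j))
    split-binomial : ∀ j → hTerm (suc m) l j ≈ nat R (suc m C j) * F j
    split-binomial j =
      trans (*-congʳ (*-congʳ (×1-homo-* (suc m C j) ((l ℕ.+ j) !))))
            (solve 4 (λ a b x y → a :* b :* x :* y := a :* (b :* (x :* y))) refl _ _ _ _)
    shift-t : ∀ j → nat R (m C j) * F (suc j) ≈ hTerm m (suc l) j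
    shift-t j =
      trans (reflexive (≡.cong (λ k → nat R (m C j) * (nat R (k !) * (s ^ (m ∸ j) * t ^ k))) (ℕ.+-suc l j)))
      (trans (solve 4 (λ a b x y → a :* (b :* (x :* y)) := a :* b :* x :* y) refl _ _ _ _)
             (*-congʳ (*-congʳ (sym (×1-homo-* (m C j) ((suc l ℕ.+ j) !))))))
    shift-s : ∀ j → j ≤ m → nat R (m C j) * F j ≈ s * hTerm m l j
    shift-s j j≤m =
      trans (reflexive (≡.cong (λ k → nat R (m C j) * (nat R ((l ℕ.+ j) !) * (s ^ k * t ^ (l ℕ.+ j)))) (ℕ.+-∸-assoc 1 j≤m)))
      (trans (solve 5 (λ a b x y z → a :* (b :* ((x :* y) :* z)) := x :* (a :* b :* y :* z)) refl _ _ _ _ _)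
             (*-congˡ (*-congʳ (*-congʳ (sym (×1-homo-* (m C j) ((l ℕ.+ j) !)))))))

  P≈h : ∀ m l → P′ (l ℕ.+ m) l ≈ h′ m l
  P≈h zero l = begin
      P′ (l ℕ.+ 0) l       ≡⟨ ≡.cong (λ n → P′ n l) (ℕ.+-identityʳ l) ⟩
      P′ l l               ≈⟨ P[n,n]≈n!*tⁿ l ⟩
      nat R (l !) * t ^ l  ≈⟨ h[0,l]≈l!*tˡ l ⟨
      h′ 0 l               ∎
  P≈h (suc m) l = begin
      P′ (l ℕ.+ suc m) l                             ≡⟨ ≡.cong (λ n → P′ n l) (ℕ.+-suc l m) ⟩
      P′ (suc (l ℕ.+ m)) l                           ≈⟨ P-recurrence (ℕ.m≤m+n l m) ⟩
      P′ (suc l ℕ.+ m) (suc l) + s * P′ (l ℕ.+ m) l  ≈⟨ +-cong (P≈h m (suc l)) (*-congˡ (P≈h m l)) ⟩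
      h′ m (suc l) + s * h′ m l                      ≈⟨ h-suc m l ⟨
      h′ (suc m) l                                   ∎

  P≈sumFromTo : ∀ m l → P′ (l ℕ.+ m) l ≈ sumFromTo R l (l ℕ.+ m)
                  (λ j → nat R (((l ℕ.+ m ∸ l) C (l ℕ.+ m ∸ j)) ℕ.* (j !)) * s ^ (l ℕ.+ m ∸ j) * t ^ j)
  P≈sumFromTo m l = begin
      P′ (l ℕ.+ m) l                                ≈⟨ P≈h m l ⟩
      h′ m l                                        ≈⟨ sumFromTo-cong m (λ i i≤m → reflexive (reindex i i≤m)) ⟨
      sumFromTo R 0 m (λ i → term (l ℕ.+ i))        ≈⟨ sumFromTo-offset l m term ⟨
      sumFromTo R l (l ℕ.+ m) term                  ∎
    where
    term : ℕ → Carrier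
    term j = nat R (((l ℕ.+ m ∸ l) C (l ℕ.+ m ∸ j)) ℕ.* (j !)) * s ^ (l ℕ.+ m ∸ j) * t ^ j
    reindex : ∀ i → i ≤ m → term (l ℕ.+ i) ≡ hTerm m l i
    reindex i i≤m rewrite ℕ.m+n∸m≡n l m | ℕ.[m+n]∸[m+o]≡n∸o l m i | ≡.sym (nCk≡nC[n∸k] i≤m) = ≡.refl

  P≈alternating-sum : ∀ {l n} → l ≤ n → P′ n l ≈ sumFromTo R 0 l (λ j → nat R (l C j) * (- 1#) ^ j * s ^ j * P′ (n ∸ j) 0)
  P≈alternating-sum {zero} {n} _ =
    sym (trans (+-identityʳ _) (trans (*-congʳ (trans (*-identityʳ _) (*-identityʳ _))) (nat[nC0]*x≈x 0 (P′ n 0))))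
  P≈alternating-sum {suc l} {suc n} (s≤s l≤n) = begin
      P′ (suc n) (suc l)
        ≈⟨ x≈y+z⇒y≈x+[-1]z (P-recurrence l≤n) ⟩
      P′ (suc n) l + - 1# * (s * P′ n l)
        ≈⟨ +-cong (P≈alternating-sum (ℕ.m≤n⇒m≤1+n l≤n)) (*-congˡ (*-congˡ (P≈alternating-sum l≤n))) ⟩
      sumFromTo R 0 l (λ j → nat R (l C j) * (- 1#) ^ j * s ^ j * P′ (suc n ∸ j) 0)
        + - 1# * (s * sumFromTo R 0 l (λ j → nat R (l C j) * (- 1#) ^ j * s ^ j * P′ (n ∸ j) 0))
        ≈⟨ +-cong (sumFromTo-cong l λ j _ → regroup l (suc n ∸ j) j)
                  (trans (sym (*-assoc (- 1#) s _))
                  (trans (sumFromTo-*ˡ (- 1# * s) l (λ j → nat R (l C j) * (- 1#) ^ j * s ^ j * P′ (n ∸ j) 0))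
                         (sumFromTo-cong l λ j _ →
                           solve 6 (λ u x a b c d → u :* x :* (a :* b :* c :* d) := a :* (u :* b :* (x :* c) :* d))
                                 refl (- 1#) s (nat R (l C j)) ((- 1#) ^ j) (s ^ j) (P′ (n ∸ j) 0)))) ⟩
      sumFromTo R 0 l (λ j → nat R (l C j) * f j) + sumFromTo R 0 l (λ j → nat R (l C j) * f (suc j))
        ≈⟨ pascal l f ⟨
      sumFromTo R 0 (suc l) (λ j → nat R (suc l C j) * f j)
        ≈⟨ sumFromTo-cong (suc l) (λ j _ → sym (regroup (suc l) (suc n ∸ j) j)) ⟩
      sumFromTo R 0 (suc l) (λ j → nat R (suc l C j) * (- 1#) ^ j * s ^ j * P′ (suc n ∸ j) 0) ∎
    where
    f : ℕ → Carrier
    f j = (- 1#) ^ j * s ^ j * P′ (suc n ∸ j) 0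
    regroup : ∀ k a j → nat R (k C j) * (- 1#) ^ j * s ^ j * P′ a 0 ≈ nat R (k C j) * ((- 1#) ^ j * s ^ j * P′ a 0)
    regroup k a j = solve 4 (λ a b c d → a :* b :* c :* d := a :* (b :* c :* d)) refl (nat R (k C j)) ((- 1#) ^ j) (s ^ j) (P′ a 0)

  sⁿ≈alternating-sum : ∀ n → s ^ n ≈ sumFromTo R 0 n (λ k → nat R (n C k) * (- 1#) ^ k * P′ n k)
  sⁿ≈alternating-sum zero =
    sym (trans (+-identityʳ _) (trans (*-congʳ (*-identityʳ _)) (trans (nat[nC0]*x≈x 0 (P′ 0 0)) (per≈laplace 0 (M R 0 0 s t)))))
  sⁿ≈alternating-sum (suc n) = begin
      s * s ^ n
        ≈⟨ *-congˡ (sⁿ≈alternating-sum n) ⟩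
      s * sumFromTo R 0 n (λ k → nat R (n C k) * (- 1#) ^ k * P′ n k)
        ≈⟨ sumFromTo-*ˡ s n (λ k → nat R (n C k) * (- 1#) ^ k * P′ n k) ⟩
      sumFromTo R 0 n (λ k → s * (nat R (n C k) * (- 1#) ^ k * P′ n k))
        ≈⟨ sumFromTo-cong n (λ k k≤n → sym (summand-recurrence k k≤n)) ⟩
      sumFromTo R 0 n (λ k → nat R (n C k) * f k + nat R (n C k) * f (suc k))
        ≈⟨ sumFromTo-+ n (λ k → nat R (n C k) * f k) (λ k → nat R (n C k) * f (suc k)) ⟩
      sumFromTo R 0 n (λ k → nat R (n C k) * f k) + sumFromTo R 0 n (λ k → nat R (n C k) * f (suc k))
        ≈⟨ pascal n f ⟨
      sumFromTo R 0 (suc n) (λ k → nat R (suc n C k) * f k)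
        ≈⟨ sumFromTo-cong (suc n) (λ k _ → sym (*-assoc (nat R (suc n C k)) ((- 1#) ^ k) (P′ (suc n) k))) ⟩
      sumFromTo R 0 (suc n) (λ k → nat R (suc n C k) * (- 1#) ^ k * P′ (suc n) k) ∎
    where
    f : ℕ → Carrier
    f k = (- 1#) ^ k * P′ (suc n) k
    summand-recurrence : ∀ k → k ≤ n → nat R (n C k) * f k + nat R (n C k) * f (suc k) ≈ s * (nat R (n C k) * (- 1#) ^ k * P′ n k)
    summand-recurrence k k≤n = begin
        κ * (σ * X) + κ * (- 1# * σ * X′)
          ≈⟨ +-congʳ (*-congˡ (*-congˡ (P-recurrence k≤n))) ⟩
        κ * (σ * (X′ + s * Y)) + κ * (- 1# * σ * X′)
          ≈⟨ solve 6 (λ κ σ X′ s Y u → κ :* (σ :* (X′ :+ s :* Y)) :+ κ :* (u :* σ :* X′)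
                                     := s :* (κ :* σ :* Y) :+ κ :* (σ :* X′) :+ u :* (κ :* (σ :* X′))) refl κ σ X′ s Y (- 1#) ⟩
        s * (κ * σ * Y) + κ * (σ * X′) + - 1# * (κ * (σ * X′))
          ≈⟨ x+y+[-1]y≈x _ _ ⟩
        s * (κ * σ * Y) ∎
      where
      κ σ X X′ Y : Carrier
      κ = nat R (n C k)
      σ = (- 1#) ^ k
      X = P′ (suc n) k
      X′ = P′ (suc n) (suc k)
      Y = P′ n k

open import Data.Nat using (_*_)
open import Data.Product using (_×_)

theorem5p3 : {c ℓ : Level} (R : CommutativeRing c ℓ) (s t : CommutativeRing.Carrier R) (n l : ℕ) → l ≤ n →
    let open CommutativeRing R renaming (_*_ to _·_) in
      ((P R n l s t ≈ h R (n ∸ l) l s t)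
        × (P R n l s t ≈ sumFromTo R l n (λ j → nat R (((n ∸ l) C (n ∸ j)) * (j !)) · pow R s (n ∸ j) · pow R t j)))
      × (P R n l s t ≈ sumFromTo R 0 l (λ j → nat R (l C j) · pow R (- 1#) j · pow R s j · P R (n ∸ j) 0 s t))
      × (pow R s n ≈ sumFromTo R 0 n (λ k → nat R (n C k) · pow R (- 1#) k · P R n k s t))
theorem5p3 R s t n l l≤n with ℕ.m≤n⇒∃[o]m+o≡n l≤n
... | m , ≡.refl =
  ( (≡.subst (λ k → P′ (l ℕ.+ m) l ≈ h′ k l) (≡.sym (ℕ.m+n∸m≡n l m)) (P≈h m l) , P≈sumFromTo m l)
  , P≈alternating-sum l≤n
  , sⁿ≈alternating-sum (l ℕ.+ m))
  where
  open PermanentOfM R s t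
  open CommutativeRing R using (_≈_)
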